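{- For $i\ge 1$ let $t(i)=i(i+1)/2$ (with $t(0)=0$). Let $\overline{I_i}\in\mathbb{Z}^{t(i)}$ be the vector with $\overline{I_i}[k]=1$ if $k=t(i-1)+1$ and $\overline{I_i}[k]=0$ otherwise. For $i\ge 2$ and $j=i-1$, let $A_{i\,j}$ be the $t(i)\times t(j)$ matrix with entries, for $1\le k\le t(i)$, $1\le l\le t(j)$, $$A_{i\,j}[k,l]=\begin{cases}-1,& k=l,\\ 1,& k-i=l,\\ 0,&\text{otherwise.}\end{cases}$$ For $n\ge 1$ define $$\overline{E_n}=\sum_{m=1}^{n} m\,A_{n\,n-1}A_{n-1\,n-2}\cdots A_{m+1\,m}\,\overline{I_m},$$ i.e. $\overline{E_n}=1\,A_{n\,n-1}\cdots A_{2\,1}\overline{I_1}+2\,A_{n\,n-1}\cdots A_{3\,2}\overline{I_2}+\cdots+(n-1)A_{n\,n-1}\overline{I_{n-1}}+n\,\overline{I_n}$. Then for $j=1,\dots,n$, $$\overline{E_n}[t(n-1)+j]=d(n+1-j),$$ where $d(k)$ denotes the number of positive divisors of $k$; that is, the last $n$ entries of $\overline{E_n}$ are $d(n),d(n-1),\dots,d(1)$.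
   Context: $d(k)$ is the number of positive divisors of the natural number $k$. Vectors are indexed starting from 1, and $\overline{E_n}$ has length $t(n)$. -}

module Defs where

open import Data.Nat as ℕ using (ℕ; zero; suc; _∸_; _≟_; _/_)
open import Data.Nat.Divisibility using (_∣?_)
open import Data.Integer as ℤ using (ℤ; +_; -_)
open import Data.List using (List; filter; length; map; sum)
open import Data.List.Base using (upTo)
open import Relation.Nullary.Decidable using (does)
open import Data.Bool using (if_then_else_)

t : ℕ → ℕ
t i = (i ℕ.* suc i) / 2

d : ℕ → ℕ
d k = length (filter (λ m → m ∣? k) (map suc (upTo k)))

-- Vectors in ℤ^{t(i)} are represented 1-indexed as functions ℕ → ℤ;
-- only the entries 1..t(i) are meaningful.
ZVec : Set
ZVec = ℕ → ℤ

Σ1 : ℕ → (ℕ → ℤ) → ℤ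
Σ1 N f = Data.List.foldr ℤ._+_ (+ 0) (map (λ l → f (suc l)) (upTo N))

Ivec : ℕ → ZVec
Ivec i k = if does (k ≟ suc (t (i ∸ 1))) then + 1 else + 0

Amat : ℕ → ℕ → ℕ → ℤ
Amat i k l =
  if does (k ≟ l) then - (+ 1)
  else if does (k ≟ l ℕ.+ i) then + 1
  else + 0

applyA : ℕ → ZVec → ZVec
applyA i v k = Σ1 (t (i ∸ 1)) (λ l → Amat i k l ℤ.* v l)

-- chain n m = A_{n,n-1} A_{n-1,n-2} ⋯ A_{m+1,m} I_m   (for m ≤ n; = I_m when n = m)
-- defined by recursion on the number of factors r = n - m
chainAux : ℕ → ℕ → ZVec
chainAux m zero = Ivec m
chainAux m (suc r) = applyA (suc r ℕ.+ m) (chainAux m r)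

chain : ℕ → ℕ → ZVec
chain n m = chainAux m (n ∸ m)

Evec : ℕ → ZVec
Evec n k = Σ1 n (λ m → + m ℤ.* chain n m k)

{-# OPTIONS --safe #-}
-- Read backwards, a vector of length t(i) is a power series of degree at most t(i); then A_{i,i-1}
-- acts as multiplication by 1 - x^i and I_m becomes x^m. So the last n entries of E_n, reversed, are
-- the coefficients of x, …, x^n in Σ_{m=1}^n m a_m, where a_m = x^m Q_m and Q_m = ∏_{i=m+1}^n (1 - x^i),
-- and the theorem says that Σ_m m a_m ≡ Σ_{q=1}^n x^q/(1 - x^q) = Σ_r d(r) x^r modulo x^{n+1}.
--
-- Put W_k(w) = Σ_{m≤n} w_m x^{km} a_m, B_k = W_k(m ↦ m), C_k = W_k(m ↦ 1), P_k = ∏_{i≤k} (1 - x^i)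
-- and D_k = Σ_{k<q≤n} x^q/(1 - x^q). From (1 - x^m) a_m = x a_{m-1} one gets, modulo x^{n+1},
-- W_k(w) - W_{k+1}(w) = x^{k+1} W_k(m ↦ w_{m+1}); hence C_k = P_k, and E_k = B_k - P_k D_k satisfies
-- (1 - x^{k+1}) E_k = E_{k+1}. As E_n ≡ 0 and 1 - x^{k+1} is invertible, E_0 ≡ 0, that is B_0 ≡ D_0.
module Submission where

open import Data.Bool as Bool using (Bool; true; false; if_then_else_)
open import Data.Unit using (tt)
open import Data.Integer using (ℤ; +_; -_; _+_; _*_; _-_; 0ℤ; 1ℤ; -1ℤ)
import Data.Integer.Properties as ℤ
open import Data.Integer.Tactic.RingSolver using (solve-∀)
open import Data.Nat using (ℕ; zero; suc; _∸_; _≤_; _<_; z≤n; s≤s; _≟_; _<?_)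
  renaming (_+_ to _+ℕ_; _*_ to _*ℕ_)
import Data.Nat.Properties as ℕ
open import Data.Nat.DivMod using (_/_; +-distrib-/-∣ʳ; m*n/n≡m)
open import Data.Nat.Tactic.RingSolver using (solve)
open import Data.Nat.Divisibility using (_∣_; divides; _∣?_; ∣-refl; ∣⇒≤; ∣m∣n⇒∣m+n; ∣m+n∣m⇒∣n)
open import Data.Nat.Induction using (<-rec)
open import Data.Sum using (inj₁; inj₂)
open import Data.List using ([]; _∷_; foldr; map; applyUpTo; upTo; filter; length)
open import Data.List.Properties using (map-∘)
open import Function using (_∘_)
open import Relation.Binary.PropositionalEquality
open import Relation.Nullary.Negation using (¬_)
open import Relation.Unary using (Decidable)
open import Relation.Nullary.Decidable using (does; yes; no; dec-true; dec-false)

open import Defs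

data Offset (i : ℕ) : ℕ → Set where
  below : ∀ {r} → r < i → Offset i r
  above : ∀ u → Offset i (i +ℕ u)

offset : ∀ i r → Offset i r
offset zero    r       = above r
offset (suc i) zero    = below (s≤s z≤n)
offset (suc i) (suc r) with offset i r
... | below r<i = below (s≤s r<i)
... | above u   = above u

∑< : ℕ → (ℕ → ℤ) → ℤ
∑< zero    f = 0ℤ
∑< (suc N) f = f 0 + ∑< N (f ∘ suc)

∑<-cong : ∀ N {f g : ℕ → ℤ} → (∀ m → m < N → f m ≡ g m) → ∑< N f ≡ ∑< N g
∑<-cong zero    f≡g = refl
∑<-cong (suc N) f≡g = cong₂ _+_ (f≡g 0 (s≤s z≤n)) (∑<-cong N (λ m m<N → f≡g (suc m) (s≤s m<N)))

∑<-zero : ∀ N {f : ℕ → ℤ} → (∀ m → m < N → f m ≡ 0ℤ) → ∑< N f ≡ 0ℤ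
∑<-zero zero    f≡0 = refl
∑<-zero (suc N) f≡0 = cong₂ _+_ (f≡0 0 (s≤s z≤n)) (∑<-zero N (λ m m<N → f≡0 (suc m) (s≤s m<N)))

∑<-+ : ∀ N (f g : ℕ → ℤ) → ∑< N (λ m → f m + g m) ≡ ∑< N f + ∑< N g
∑<-+ zero    f g = refl
∑<-+ (suc N) f g = trans (cong (_+_ (f 0 + g 0)) (∑<-+ N _ _)) (interchange (f 0) (g 0) _ _)
  where
  interchange : ∀ a b c d → (a + b) + (c + d) ≡ (a + c) + (b + d)
  interchange = solve-∀

∑<-- : ∀ N (f g : ℕ → ℤ) → ∑< N (λ m → f m - g m) ≡ ∑< N f - ∑< N g
∑<-- zero    f g = refl
∑<-- (suc N) f g = trans (cong (_+_ (f 0 - g 0)) (∑<-- N _ _)) (interchange (f 0) (g 0) _ _)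
  where
  interchange : ∀ a b c d → (a - b) + (c - d) ≡ (a + c) - (b + d)
  interchange = solve-∀

∑<-suc : ∀ N (f : ℕ → ℤ) → ∑< (suc N) f ≡ ∑< N f + f N
∑<-suc zero    f = ℤ.+-comm (f 0) 0ℤ
∑<-suc (suc N) f = trans (cong (_+_ (f 0)) (∑<-suc N _)) (sym (ℤ.+-assoc (f 0) _ _))

∑<-+ℕ : ∀ a b (f : ℕ → ℤ) → ∑< (a +ℕ b) f ≡ ∑< a f + ∑< b (λ i → f (a +ℕ i))
∑<-+ℕ zero    b f = sym (ℤ.+-identityˡ _)
∑<-+ℕ (suc a) b f = trans (cong (_+_ (f 0)) (∑<-+ℕ a b _)) (sym (ℤ.+-assoc (f 0) _ _))

∑<-telescope : ∀ N (f g : ℕ → ℤ) → f 0 ≡ g 0 → (∀ m → m < N → f (suc m) ≡ g (suc m) - g m) →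
               ∑< (suc N) f ≡ g N
∑<-telescope zero    f g f0 fsuc = trans (ℤ.+-identityʳ (f 0)) f0
∑<-telescope (suc N) f g f0 fsuc = begin
    ∑< (suc (suc N)) f             ≡⟨ ∑<-suc (suc N) f ⟩
    ∑< (suc N) f + f (suc N)       ≡⟨ cong₂ _+_ (∑<-telescope N f g f0 (λ m m<N → fsuc m (ℕ.m≤n⇒m≤1+n m<N)))
                                                (fsuc N ℕ.≤-refl) ⟩
    g N + (g (suc N) - g N)        ≡⟨ cancel (g N) (g (suc N)) ⟩
    g (suc N)                      ∎
  where
  open ≡-Reasoning
  cancel : ∀ a b → a + (b - a) ≡ b
  cancel = solve-∀

∑<-single : ∀ N (f : ℕ → ℤ) a → (∀ l → l ≢ a → f l ≡ 0ℤ) → a < N → ∑< N f ≡ f a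
∑<-single (suc N) f a f≡0 (s≤s a≤N) with ℕ.m≤n⇒m<n∨m≡n a≤N
... | inj₁ a<N = begin
    ∑< (suc N) f     ≡⟨ ∑<-suc N f ⟩
    ∑< N f + f N     ≡⟨ cong₂ _+_ (∑<-single N f a f≡0 a<N) (f≡0 N (ℕ.<⇒≢ a<N ∘ sym)) ⟩
    f a + 0ℤ         ≡⟨ ℤ.+-identityʳ (f a) ⟩
    f a              ∎
  where open ≡-Reasoning
... | inj₂ refl = begin
    ∑< (suc N) f     ≡⟨ ∑<-suc N f ⟩
    ∑< N f + f N     ≡⟨ cong (_+ f N) (∑<-zero N (λ l l<N → f≡0 l (ℕ.<⇒≢ l<N))) ⟩
    0ℤ + f N         ≡⟨ ℤ.+-identityˡ (f N) ⟩
    f N              ∎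
  where open ≡-Reasoning

foldr-map-applyUpTo : ∀ (f : ℕ → ℤ) (h : ℕ → ℕ) N → foldr _+_ 0ℤ (map f (applyUpTo h N)) ≡ ∑< N (f ∘ h)
foldr-map-applyUpTo f h zero    = refl
foldr-map-applyUpTo f h (suc N) = cong (_+_ (f (h 0))) (foldr-map-applyUpTo f (h ∘ suc) N)

Σ1≡∑< : ∀ N f → Σ1 N f ≡ ∑< N (f ∘ suc)
Σ1≡∑< N f = foldr-map-applyUpTo (f ∘ suc) (λ l → l) N

Series : Set
Series = ℕ → ℤ

0ₛ : Series
0ₛ _ = 0ℤ

one : Series
one zero    = 1ℤ
one (suc r) = 0ℤ

infixr 7 x^_·_ [1-x^_]·_
infix 4 _≈[≤_]_

x^_·_ : ℕ → Series → Series
(x^ zero  · s) r       = s r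
(x^ suc i · s) zero    = 0ℤ
(x^ suc i · s) (suc r) = (x^ i · s) r

[1-x^_]·_ : ℕ → Series → Series
([1-x^ i ]· s) r = s r - (x^ i · s) r

_≈[≤_]_ : Series → ℕ → Series → Set
s ≈[≤ R ] s′ = ∀ r → r ≤ R → s r ≡ s′ r

x^-cong : ∀ i {s s′ : Series} → s ≗ s′ → x^ i · s ≗ x^ i · s′
x^-cong zero    s≗s′ r       = s≗s′ r
x^-cong (suc i) s≗s′ zero    = refl
x^-cong (suc i) s≗s′ (suc r) = x^-cong i s≗s′ r

x^-local : ∀ i {s s′ : Series} r → s ≈[≤ r ] s′ → (x^ i · s) r ≡ (x^ i · s′) r
x^-local zero    r       s≈s′ = s≈s′ r ℕ.≤-refl
x^-local (suc i) zero    s≈s′ = refl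
x^-local (suc i) (suc r) s≈s′ = x^-local i r (λ r′ r′≤r → s≈s′ r′ (ℕ.m≤n⇒m≤1+n r′≤r))

x^-map : ∀ (op : ℤ → ℤ) → op 0ℤ ≡ 0ℤ → ∀ i (s : Series) →
         x^ i · (op ∘ s) ≗ op ∘ (x^ i · s)
x^-map op op0 zero    s r       = refl
x^-map op op0 (suc i) s zero    = sym op0
x^-map op op0 (suc i) s (suc r) = x^-map op op0 i s r

x^-map₂ : ∀ (op : ℤ → ℤ → ℤ) → op 0ℤ 0ℤ ≡ 0ℤ → ∀ i (s s′ : Series) →
          x^ i · (λ r → op (s r) (s′ r)) ≗ λ r → op ((x^ i · s) r) ((x^ i · s′) r)
x^-map₂ op op0 zero    s s′ r       = refl
x^-map₂ op op0 (suc i) s s′ zero    = sym op0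
x^-map₂ op op0 (suc i) s s′ (suc r) = x^-map₂ op op0 i s s′ r

x^-+ : ∀ i (s s′ : Series) → x^ i · (λ r → s r + s′ r) ≗ λ r → (x^ i · s) r + (x^ i · s′) r
x^-+ = x^-map₂ _+_ refl

x^-- : ∀ i (s s′ : Series) → x^ i · (λ r → s r - s′ r) ≗ λ r → (x^ i · s) r - (x^ i · s′) r
x^-- = x^-map₂ _-_ refl

x^-scale : ∀ c i (s : Series) → x^ i · (λ r → c * s r) ≗ λ r → c * (x^ i · s) r
x^-scale c = x^-map (c *_) (ℤ.*-zeroʳ c)

x^-0 : ∀ i → x^ i · 0ₛ ≗ 0ₛ
x^-0 i = x^-map (λ _ → 0ℤ) refl i 0ₛ

x^-∑< : ∀ N i (F : ℕ → Series) → x^ i · (λ r → ∑< N (λ m → F m r)) ≗ λ r → ∑< N (λ m → (x^ i · F m) r)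
x^-∑< N zero    F r       = refl
x^-∑< N (suc i) F zero    = sym (∑<-zero N (λ _ _ → refl))
x^-∑< N (suc i) F (suc r) = x^-∑< N i F r

x^-x^ : ∀ i j (s : Series) → x^ i · x^ j · s ≗ x^ (i +ℕ j) · s
x^-x^ zero    j s r       = refl
x^-x^ (suc i) j s zero    = refl
x^-x^ (suc i) j s (suc r) = x^-x^ i j s r

x^-comm : ∀ i j (s : Series) → x^ i · x^ j · s ≗ x^ j · x^ i · s
x^-comm i j s r = begin
  (x^ i · x^ j · s) r    ≡⟨ x^-x^ i j s r ⟩
  (x^ (i +ℕ j) · s) r    ≡⟨ cong (λ k → (x^ k · s) r) (ℕ.+-comm i j) ⟩
  (x^ (j +ℕ i) · s) r    ≡⟨ x^-x^ j i s r ⟨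
  (x^ j · x^ i · s) r    ∎
  where open ≡-Reasoning

x^-below : ∀ i (s : Series) {r} → r < i → (x^ i · s) r ≡ 0ℤ
x^-below (suc i) s {zero}  r<i       = refl
x^-below (suc i) s {suc r} (s≤s r<i) = x^-below i s r<i

x^-above : ∀ i (s : Series) u → (x^ i · s) (i +ℕ u) ≡ s u
x^-above zero    s u = refl
x^-above (suc i) s u = x^-above i s u

x^-upto : ∀ i (s : Series) → s 0 ≡ 0ℤ → ∀ r → r ≤ i → (x^ i · s) r ≡ 0ℤ
x^-upto i s s0 r r≤i with offset i r
... | below r<i = x^-below i s r<i
... | above u   = trans (x^-above i s u) (subst (λ v → s v ≡ 0ℤ) (sym u≡0) s0)
  where
  u≡0 : u ≡ 0
  u≡0 = ℕ.n≤0⇒n≡0 (ℕ.+-cancelˡ-≤ i u 0 (subst (i +ℕ u ≤_) (sym (ℕ.+-identityʳ i)) r≤i))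

[1-x^]-cong : ∀ i {s s′ : Series} → s ≗ s′ → [1-x^ i ]· s ≗ [1-x^ i ]· s′
[1-x^]-cong i s≗s′ r = cong₂ _-_ (s≗s′ r) (x^-cong i s≗s′ r)

[1-x^]-local : ∀ i {s s′ : Series} r → s ≈[≤ r ] s′ → ([1-x^ i ]· s) r ≡ ([1-x^ i ]· s′) r
[1-x^]-local i r s≈s′ = cong₂ _-_ (s≈s′ r ℕ.≤-refl) (x^-local i r s≈s′)

[1-x^]-+ : ∀ i (s s′ : Series) → [1-x^ i ]· (λ r → s r + s′ r) ≗ λ r → ([1-x^ i ]· s) r + ([1-x^ i ]· s′) r
[1-x^]-+ i s s′ r = trans (cong (_-_ (s r + s′ r)) (x^-+ i s s′ r)) (regroup (s r) (s′ r) _ _)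
  where
  regroup : ∀ a b c d → (a + b) - (c + d) ≡ (a - c) + (b - d)
  regroup = solve-∀

[1-x^]-- : ∀ i (s s′ : Series) → [1-x^ i ]· (λ r → s r - s′ r) ≗ λ r → ([1-x^ i ]· s) r - ([1-x^ i ]· s′) r
[1-x^]-- i s s′ r = trans (cong (_-_ (s r - s′ r)) (x^-- i s s′ r)) (regroup (s r) (s′ r) _ _)
  where
  regroup : ∀ a b c d → (a - b) - (c - d) ≡ (a - c) - (b - d)
  regroup = solve-∀

[1-x^]-0 : ∀ i → [1-x^ i ]· 0ₛ ≗ 0ₛ
[1-x^]-0 i r = cong (_-_ 0ℤ) (x^-0 i r)

x^-[1-x^] : ∀ i j (s : Series) → x^ i · [1-x^ j ]· s ≗ [1-x^ j ]· x^ i · s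
x^-[1-x^] i j s r = trans (x^-- i s (x^ j · s) r) (cong (_-_ ((x^ i · s) r)) (x^-comm i j s r))

[1-x^]-comm : ∀ i j (s : Series) → [1-x^ i ]· [1-x^ j ]· s ≗ [1-x^ j ]· [1-x^ i ]· s
[1-x^]-comm i j s r = begin
  (s r - sj r) - (x^ i · (λ x → s x - sj x)) r  ≡⟨ cong (_-_ (s r - sj r)) (x^-- i s sj r) ⟩
  (s r - sj r) - (si r - (x^ i · sj) r)         ≡⟨ cong (λ z → (s r - sj r) - (si r - z)) (x^-comm i j s r) ⟩
  (s r - sj r) - (si r - (x^ j · si) r)         ≡⟨ swap (s r) (sj r) (si r) _ ⟩
  (s r - si r) - (sj r - (x^ j · si) r)         ≡⟨ cong (_-_ (s r - si r)) (x^-- j s si r) ⟨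
  (s r - si r) - (x^ j · (λ x → s x - si x)) r  ∎
  where
  open ≡-Reasoning
  si sj : Series
  si = x^ i · s
  sj = x^ j · s
  swap : ∀ a b c d → (a - b) - (c - d) ≡ (a - c) - (b - d)
  swap = solve-∀

[1-x^]-cancel : ∀ i {s : Series} R → 1 ≤ i → [1-x^ i ]· s ≈[≤ R ] 0ₛ → s ≈[≤ R ] 0ₛ
[1-x^]-cancel i {s} R 1≤i [1-x^i]s≈0 = <-rec (λ r → r ≤ R → s r ≡ 0ℤ) step
  where
  split : ∀ a b → a ≡ (a - b) + b
  split = solve-∀
  step : ∀ r → (∀ {r′} → r′ < r → r′ ≤ R → s r′ ≡ 0ℤ) → r ≤ R → s r ≡ 0ℤ
  step r ih r≤R = trans (split (s r) ((x^ i · s) r)) (cong₂ _+_ ([1-x^i]s≈0 r r≤R) (shifted (offset i r) ih r≤R))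
    where
    shifted : ∀ {r} → Offset i r → (∀ {r′} → r′ < r → r′ ≤ R → s r′ ≡ 0ℤ) → r ≤ R → (x^ i · s) r ≡ 0ℤ
    shifted (below r<i) ih r≤R = x^-below i s r<i
    shifted (above u)   ih r≤R =
      trans (x^-above i s u) (ih (ℕ.m<n+m u 1≤i) (ℕ.≤-trans (ℕ.m≤n+m u i) r≤R))

∏[1-x^] : ℕ → ℕ → Series → Series
∏[1-x^] m zero    s = s
∏[1-x^] m (suc j) s = [1-x^ suc j +ℕ m ]· ∏[1-x^] m j s

∏[1-x^]-cong : ∀ m j {s s′ : Series} → s ≗ s′ → ∏[1-x^] m j s ≗ ∏[1-x^] m j s′
∏[1-x^]-cong m zero    s≗s′ = s≗s′
∏[1-x^]-cong m (suc j) s≗s′ = [1-x^]-cong (suc j +ℕ m) (∏[1-x^]-cong m j s≗s′)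

∏[1-x^]-local : ∀ m j {s s′ : Series} r → s ≈[≤ r ] s′ → ∏[1-x^] m j s r ≡ ∏[1-x^] m j s′ r
∏[1-x^]-local m zero    r s≈s′ = s≈s′ r ℕ.≤-refl
∏[1-x^]-local m (suc j) r s≈s′ = [1-x^]-local (suc j +ℕ m) r
  (λ r′ r′≤r → ∏[1-x^]-local m j r′ (λ r″ r″≤r′ → s≈s′ r″ (ℕ.≤-trans r″≤r′ r′≤r)))

∏[1-x^]-+ : ∀ m j (s s′ : Series) →
            ∏[1-x^] m j (λ r → s r + s′ r) ≗ λ r → ∏[1-x^] m j s r + ∏[1-x^] m j s′ r
∏[1-x^]-+ m zero    s s′ r = refl
∏[1-x^]-+ m (suc j) s s′ r = trans ([1-x^]-cong (suc j +ℕ m) (∏[1-x^]-+ m j s s′) r)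
                                    ([1-x^]-+ (suc j +ℕ m) (∏[1-x^] m j s) (∏[1-x^] m j s′) r)

∏[1-x^]-0 : ∀ m j → ∏[1-x^] m j 0ₛ ≗ 0ₛ
∏[1-x^]-0 m zero    r = refl
∏[1-x^]-0 m (suc j) r = trans ([1-x^]-cong (suc j +ℕ m) (∏[1-x^]-0 m j) r) ([1-x^]-0 (suc j +ℕ m) r)

[1-x^]-∏[1-x^] : ∀ i m j (s : Series) → [1-x^ i ]· ∏[1-x^] m j s ≗ ∏[1-x^] m j ([1-x^ i ]· s)
[1-x^]-∏[1-x^] i m zero    s r = refl
[1-x^]-∏[1-x^] i m (suc j) s r = trans ([1-x^]-comm i (suc j +ℕ m) (∏[1-x^] m j s) r)
                                        ([1-x^]-cong (suc j +ℕ m) ([1-x^]-∏[1-x^] i m j s) r)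

x^-∏[1-x^] : ∀ i m j (s : Series) → x^ i · ∏[1-x^] m j s ≗ ∏[1-x^] m j (x^ i · s)
x^-∏[1-x^] i m zero    s r = refl
x^-∏[1-x^] i m (suc j) s r = trans (x^-[1-x^] i (suc j +ℕ m) (∏[1-x^] m j s) r)
                                    ([1-x^]-cong (suc j +ℕ m) (x^-∏[1-x^] i m j s) r)

∏[1-x^]-from-0 : ∀ k (s : Series) → ∏[1-x^] 0 (suc k) s ≗ [1-x^ suc k ]· ∏[1-x^] 0 k s
∏[1-x^]-from-0 k s r = cong (λ i → ([1-x^ i ]· ∏[1-x^] 0 k s) r) (ℕ.+-identityʳ (suc k))

∏[1-x^]-suc-inner : ∀ m j (s : Series) → ∏[1-x^] m (suc j) s ≗ ∏[1-x^] (suc m) j ([1-x^ suc m ]· s)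
∏[1-x^]-suc-inner m zero    s r = refl
∏[1-x^]-suc-inner m (suc j) s r rewrite ℕ.+-suc j m =
  [1-x^]-cong (suc (suc (j +ℕ m))) (∏[1-x^]-suc-inner m j s) r

indicator : Bool → ℤ
indicator b = if b then 1ℤ else 0ℤ

length-filter≡∑indicator : ∀ {A : Set} {P : A → Set} (P? : Decidable P) xs →
  + length (filter P? xs) ≡ foldr _+_ 0ℤ (map (indicator ∘ does ∘ P?) xs)
length-filter≡∑indicator P? []       = refl
length-filter≡∑indicator P? (x ∷ xs) with does (P? x)
... | true  = cong (_+_ 1ℤ) (length-filter≡∑indicator P? xs)
... | false = trans (length-filter≡∑indicator P? xs) (sym (ℤ.+-identityˡ _))

multiples : ℕ → Series
multiples q zero    = 0ℤ
multiples q (suc r) = indicator (does (q ∣? suc r))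

multiples-∣ : ∀ q r → q ∣ suc r → multiples q (suc r) ≡ 1ℤ
multiples-∣ q r q∣ = cong indicator (dec-true (q ∣? suc r) q∣)

multiples-∤ : ∀ q r → ¬ q ∣ suc r → multiples q (suc r) ≡ 0ℤ
multiples-∤ q r q∤ = cong indicator (dec-false (q ∣? suc r) q∤)

multiples-below : ∀ q r → r < q → multiples q r ≡ 0ℤ
multiples-below q zero    r<q = refl
multiples-below q (suc r) r<q = multiples-∤ q r (λ q∣ → ℕ.<⇒≱ r<q (∣⇒≤ q∣))

[1-x^]-multiples : ∀ q → [1-x^ suc q ]· multiples (suc q) ≗ x^ suc q · one
[1-x^]-multiples q r with offset (suc q) r
... | below r<q = trans (cong₂ _-_ (multiples-below (suc q) r r<q) (x^-below (suc q) _ r<q))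
                        (sym (x^-below (suc q) one r<q))
... | above u   = trans (cong (_-_ (multiples (suc q) (suc q +ℕ u))) (x^-above (suc q) _ u))
                        (trans (difference u) (sym (x^-above (suc q) one u)))
  where
  difference : ∀ u → multiples (suc q) (suc q +ℕ u) - multiples (suc q) u ≡ one u
  difference zero = cong (_- 0ℤ) (multiples-∣ (suc q) (q +ℕ 0) (subst (λ x → suc q ∣ suc x) (sym (ℕ.+-identityʳ q)) ∣-refl))
  difference (suc u) with suc q ∣? suc u
  ... | yes q∣u = cong₂ _-_ (multiples-∣ (suc q) (q +ℕ suc u) (∣m∣n⇒∣m+n ∣-refl q∣u)) (multiples-∣ (suc q) u q∣u)
  ... | no  q∤u = cong₂ _-_ (multiples-∤ (suc q) (q +ℕ suc u) (λ q∣ → q∤u (∣m+n∣m⇒∣n q∣ ∣-refl))) (multiples-∤ (suc q) u q∤u)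

∑<multiples≡d : ∀ n R → suc R ≤ n → ∑< n (λ j → multiples (suc j) (suc R)) ≡ + d (suc R)
∑<multiples≡d n R R<n = begin
    ∑< n term                                          ≡⟨ cong (λ N → ∑< N term) (ℕ.m+[n∸m]≡n R<n) ⟨
    ∑< (suc R +ℕ (n ∸ suc R)) term                     ≡⟨ ∑<-+ℕ (suc R) (n ∸ suc R) term ⟩
    ∑< (suc R) term + ∑< (n ∸ suc R) (term ∘ (suc R +ℕ_)) ≡⟨ cong (_+_ (∑< (suc R) term)) (∑<-zero (n ∸ suc R) beyondR) ⟩
    ∑< (suc R) term + 0ℤ                               ≡⟨ ℤ.+-identityʳ _ ⟩
    ∑< (suc R) term                                    ≡⟨ foldr-map-applyUpTo term (λ l → l) (suc R) ⟨
    foldr _+_ 0ℤ (map (ind ∘ suc) (upTo (suc R)))   ≡⟨ cong (foldr _+_ 0ℤ) (map-∘ {g = ind} {f = suc} (upTo (suc R))) ⟩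
    foldr _+_ 0ℤ (map ind (map suc (upTo (suc R)))) ≡⟨ length-filter≡∑indicator (_∣? suc R) (map suc (upTo (suc R))) ⟨
    + d (suc R)                                     ∎
  where
  open ≡-Reasoning
  ind : ℕ → ℤ
  ind j = indicator (does (j ∣? suc R))
  term : ℕ → ℤ
  term j = multiples (suc j) (suc R)
  beyondR : ∀ i → i < n ∸ suc R → term (suc R +ℕ i) ≡ 0ℤ
  beyondR i _ = multiples-below (suc (suc R +ℕ i)) (suc R) (s≤s (ℕ.m≤m+n (suc R) i))

module DivisorSeries (n : ℕ) where

  Q : ℕ → Series
  Q m = ∏[1-x^] m (n ∸ m) one

  a : ℕ → Series
  a m = x^ m · Q m

  Q-step : ∀ m → m < n → Q m ≗ [1-x^ suc m ]· Q (suc m)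
  Q-step m m<n r = begin
    ∏[1-x^] m (n ∸ m) one r                              ≡⟨ cong (λ j → ∏[1-x^] m j one r) (ℕ.+-∸-assoc 1 m<n) ⟩
    ∏[1-x^] m (suc (n ∸ suc m)) one r                    ≡⟨ ∏[1-x^]-suc-inner m (n ∸ suc m) one r ⟩
    ∏[1-x^] (suc m) (n ∸ suc m) ([1-x^ suc m ]· one) r   ≡⟨ [1-x^]-∏[1-x^] (suc m) (suc m) (n ∸ suc m) one r ⟨
    ([1-x^ suc m ]· Q (suc m)) r                         ∎
    where open ≡-Reasoning

  a-step : ∀ m → m < n → [1-x^ suc m ]· a (suc m) ≗ x^ 1 · a m
  a-step m m<n r = begin
    ([1-x^ suc m ]· x^ suc m · Q (suc m)) r   ≡⟨ x^-[1-x^] (suc m) (suc m) (Q (suc m)) r ⟨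
    (x^ suc m · [1-x^ suc m ]· Q (suc m)) r   ≡⟨ x^-cong (suc m) (Q-step m m<n) r ⟨
    (x^ suc m · Q m) r                        ≡⟨ x^-x^ 1 m (Q m) r ⟨
    (x^ 1 · a m) r                            ∎
    where open ≡-Reasoning

  W : ℕ → (ℕ → ℤ) → Series
  W k w r = ∑< (suc n) (λ m → w m * (x^ (k *ℕ m) · a m) r)

  W-difference : ∀ k w r →
    W k w r - W (suc k) w r ≡ ∑< n (λ m → w (suc m) * (x^ (k *ℕ suc m +ℕ 1) · a m) r)
  W-difference k w r = begin
      W k w r - W (suc k) w r
    ≡⟨ ∑<-- (suc n) (λ m → w m * (x^ (k *ℕ m) · a m) r) (λ m → w m * (x^ (m +ℕ k *ℕ m) · a m) r) ⟨
      ∑< (suc n) (λ m → w m * (x^ (k *ℕ m) · a m) r - w m * (x^ (m +ℕ k *ℕ m) · a m) r)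
    ≡⟨ ∑<-cong (suc n) (λ m _ → factor m) ⟩
      w 0 * (x^ (k *ℕ 0) · [1-x^ 0 ]· a 0) r + ∑< n (λ m → w (suc m) * (x^ (k *ℕ suc m) · [1-x^ suc m ]· a (suc m)) r)
    ≡⟨ cong₂ _+_ first (∑<-cong n (λ m m<n → cong (w (suc m) *_) (rest m m<n))) ⟩
      0ℤ + ∑< n (λ m → w (suc m) * (x^ (k *ℕ suc m +ℕ 1) · a m) r)
    ≡⟨ ℤ.+-identityˡ _ ⟩
      ∑< n (λ m → w (suc m) * (x^ (k *ℕ suc m +ℕ 1) · a m) r)
    ∎
    where
    open ≡-Reasoning
    distrib : ∀ c x y → c * x - c * y ≡ c * (x - y)
    distrib = solve-∀
    factor : ∀ m → w m * (x^ (k *ℕ m) · a m) r - w m * (x^ (m +ℕ k *ℕ m) · a m) r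
                 ≡ w m * (x^ (k *ℕ m) · [1-x^ m ]· a m) r
    factor m = begin
      w m * (x^ (k *ℕ m) · a m) r - w m * (x^ (m +ℕ k *ℕ m) · a m) r
        ≡⟨ distrib (w m) _ _ ⟩
      w m * ((x^ (k *ℕ m) · a m) r - (x^ (m +ℕ k *ℕ m) · a m) r)
        ≡⟨ cong (λ z → w m * ((x^ (k *ℕ m) · a m) r - z))
                (trans (cong (λ i → (x^ i · a m) r) (ℕ.+-comm m (k *ℕ m))) (sym (x^-x^ (k *ℕ m) m (a m) r))) ⟩
      w m * ((x^ (k *ℕ m) · a m) r - (x^ (k *ℕ m) · x^ m · a m) r)
        ≡⟨ cong (w m *_) (x^-- (k *ℕ m) (a m) (x^ m · a m) r) ⟨
      w m * (x^ (k *ℕ m) · [1-x^ m ]· a m) r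
        ∎
    first : w 0 * (x^ (k *ℕ 0) · [1-x^ 0 ]· a 0) r ≡ 0ℤ
    first = begin
      w 0 * (x^ (k *ℕ 0) · [1-x^ 0 ]· a 0) r  ≡⟨ cong (λ i → w 0 * (x^ i · [1-x^ 0 ]· a 0) r) (ℕ.*-zeroʳ k) ⟩
      w 0 * (a 0 r - a 0 r)                   ≡⟨ cong (w 0 *_) (ℤ.+-inverseʳ (a 0 r)) ⟩
      w 0 * 0ℤ                                ≡⟨ ℤ.*-zeroʳ (w 0) ⟩
      0ℤ                                      ∎
    rest : ∀ m → m < n → (x^ (k *ℕ suc m) · [1-x^ suc m ]· a (suc m)) r ≡ (x^ (k *ℕ suc m +ℕ 1) · a m) r
    rest m m<n = trans (x^-cong (k *ℕ suc m) (a-step m m<n) r) (x^-x^ (k *ℕ suc m) 1 (a m) r)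

  W-shift : ∀ k w r → r ≤ n → (x^ suc k · W k w) r ≡ ∑< n (λ m → w m * (x^ (k *ℕ suc m +ℕ 1) · a m) r)
  W-shift k w r r≤n = begin
      (x^ suc k · W k w) r
    ≡⟨ x^-∑< (suc n) (suc k) (λ m x → w m * (x^ (k *ℕ m) · a m) x) r ⟩
      ∑< (suc n) (λ m → (x^ suc k · (λ x → w m * (x^ (k *ℕ m) · a m) x)) r)
    ≡⟨ ∑<-cong (suc n) (λ m _ → trans (x^-scale (w m) (suc k) _ r) (cong (w m *_) (x^-x^ (suc k) (k *ℕ m) (a m) r))) ⟩
      ∑< (suc n) term
    ≡⟨ ∑<-suc n term ⟩
      ∑< n term + term n
    ≡⟨ cong₂ _+_ (∑<-cong n (λ m _ → cong (λ i → w m * (x^ i · a m) r) (reassoc m))) last-vanishes ⟩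
      ∑< n (λ m → w m * (x^ (k *ℕ suc m +ℕ 1) · a m) r) + 0ℤ
    ≡⟨ ℤ.+-identityʳ _ ⟩
      ∑< n (λ m → w m * (x^ (k *ℕ suc m +ℕ 1) · a m) r)
    ∎
    where
    open ≡-Reasoning
    term : ℕ → ℤ
    term m = w m * (x^ (suc k +ℕ k *ℕ m) · a m) r
    reassoc : ∀ m → suc k +ℕ k *ℕ m ≡ k *ℕ suc m +ℕ 1
    reassoc m = trans (cong suc (sym (ℕ.*-suc k m))) (ℕ.+-comm 1 (k *ℕ suc m))
    last-vanishes : term n ≡ 0ℤ
    last-vanishes = trans (cong (w n *_) (trans (x^-x^ (suc k +ℕ k *ℕ n) n (Q n) r)
                      (x^-below _ (Q n) (s≤s (ℕ.≤-trans r≤n (ℕ.m≤n+m n (k +ℕ k *ℕ n)))))))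
                    (ℤ.*-zeroʳ (w n))

  W-recurrence : ∀ k w r → r ≤ n → W k w r - W (suc k) w r ≡ (x^ suc k · W k (w ∘ suc)) r
  W-recurrence k w r r≤n = trans (W-difference k w r) (sym (W-shift k (w ∘ suc) r r≤n))

  B C : ℕ → Series
  B k = W k (λ m → + m)
  C k = W k (λ _ → 1ℤ)

  B-step : ∀ k r → r ≤ n → ([1-x^ suc k ]· B k) r ≡ B (suc k) r + (x^ suc k · C k) r
  B-step k r r≤n = rearrange (B k r) (B (suc k) r) _ _ (begin
      B k r - B (suc k) r                           ≡⟨ W-recurrence k (λ m → + m) r r≤n ⟩
      (x^ suc k · W k (λ m → + suc m)) r            ≡⟨ x^-cong (suc k) split r ⟩
      (x^ suc k · (λ x → B k x + C k x)) r          ≡⟨ x^-+ (suc k) (B k) (C k) r ⟩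
      (x^ suc k · B k) r + (x^ suc k · C k) r       ∎)
    where
    open ≡-Reasoning
    rearrange : ∀ b b′ x y → b - b′ ≡ x + y → b - x ≡ b′ + y
    rearrange b b′ x y eq = trans (insert b b′ x) (trans (cong (λ z → z + b′ - x) eq) (cancel x y b′))
      where
      insert : ∀ b b′ x → b - x ≡ (b - b′) + b′ - x
      insert = solve-∀
      cancel : ∀ x y b′ → (x + y) + b′ - x ≡ b′ + y
      cancel = solve-∀
    distrib : ∀ m x → (1ℤ + m) * x ≡ m * x + 1ℤ * x
    distrib = solve-∀
    split : W k (λ m → + suc m) ≗ λ x → B k x + C k x
    split x = trans (∑<-cong (suc n) (λ m _ → distrib (+ m) (term m)))
                    (∑<-+ (suc n) (λ m → + m * term m) (λ m → 1ℤ * term m))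
      where
      term : ℕ → ℤ
      term m = (x^ (k *ℕ m) · a m) x

  C-step : ∀ k r → r ≤ n → ([1-x^ suc k ]· C k) r ≡ C (suc k) r
  C-step k r r≤n = rearrange (C k r) (C (suc k) r) _ (W-recurrence k (λ _ → 1ℤ) r r≤n)
    where
    rearrange : ∀ b b′ x → b - b′ ≡ x → b - x ≡ b′
    rearrange b b′ x eq = trans (insert b b′ x) (trans (cong (λ z → z + b′ - x) eq) (cancel x b′))
      where
      insert : ∀ b b′ x → b - x ≡ (b - b′) + b′ - x
      insert = solve-∀
      cancel : ∀ x b′ → x + b′ - x ≡ b′
      cancel = solve-∀

  C-zero : C 0 ≗ one
  C-zero r = trans (∑<-telescope n (λ m → 1ℤ * a m r) (λ m → Q m r) (ℤ.*-identityˡ _) a≡ΔQ)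
                   (cong (λ j → ∏[1-x^] n j one r) (ℕ.n∸n≡0 n))
    where
    undo : ∀ x y → x ≡ y - (y - x)
    undo = solve-∀
    a≡ΔQ : ∀ m → m < n → 1ℤ * a (suc m) r ≡ Q (suc m) r - Q m r
    a≡ΔQ m m<n = trans (ℤ.*-identityˡ _)
      (trans (undo (a (suc m) r) (Q (suc m) r)) (cong (_-_ (Q (suc m) r)) (sym (Q-step m m<n r))))

  C≈∏ : ∀ k → C k ≈[≤ n ] ∏[1-x^] 0 k one
  C≈∏ zero    r r≤n = C-zero r
  C≈∏ (suc k) r r≤n = begin
    C (suc k) r                             ≡⟨ C-step k r r≤n ⟨
    ([1-x^ suc k ]· C k) r                  ≡⟨ [1-x^]-local (suc k) r (λ r′ r′≤r → C≈∏ k r′ (ℕ.≤-trans r′≤r r≤n)) ⟩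
    ([1-x^ suc k ]· ∏[1-x^] 0 k one) r      ≡⟨ ∏[1-x^]-from-0 k one r ⟨
    ∏[1-x^] 0 (suc k) one r                 ∎
    where open ≡-Reasoning

  D : ℕ → Series
  D k r = ∑< (n ∸ k) (λ i → multiples (suc (k +ℕ i)) r)

  D-step : ∀ k → k < n → D k ≗ λ r → multiples (suc k) r + D (suc k) r
  D-step k k<n r = trans (cong (λ N → ∑< N (λ i → multiples (suc (k +ℕ i)) r)) (ℕ.+-∸-assoc 1 k<n))
    (cong₂ _+_ (cong (λ x → multiples (suc x) r) (ℕ.+-identityʳ k))
               (∑<-cong (n ∸ suc k) (λ i _ → cong (λ x → multiples (suc x) r) (ℕ.+-suc k i))))

  D-n : D n ≗ 0ₛ
  D-n r = cong (λ N → ∑< N (λ i → multiples (suc (n +ℕ i)) r)) (ℕ.n∸n≡0 n)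

  E : ℕ → Series
  E k r = B k r - ∏[1-x^] 0 k (D k) r

  E-step : ∀ k → k < n → ∀ r → r ≤ n → ([1-x^ suc k ]· E k) r ≡ E (suc k) r
  E-step k k<n r r≤n = begin
      ([1-x^ suc k ]· E k) r
    ≡⟨ [1-x^]-- (suc k) (B k) (∏[1-x^] 0 k (D k)) r ⟩
      ([1-x^ suc k ]· B k) r - ([1-x^ suc k ]· ∏[1-x^] 0 k (D k)) r
    ≡⟨ cong₂ _-_ (trans (B-step k r r≤n) (cong (_+_ (B (suc k) r)) (x^-local (suc k) r C≈∏k)))
                 (sym (∏[1-x^]-from-0 k (D k) r)) ⟩
      (B (suc k) r + S) - ∏[1-x^] 0 (suc k) (D k) r
    ≡⟨ cong (_-_ (B (suc k) r + S)) (trans (∏[1-x^]-cong 0 (suc k) (D-step k k<n) r)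
                                            (∏[1-x^]-+ 0 (suc k) (multiples (suc k)) (D (suc k)) r)) ⟩
      (B (suc k) r + S) - (∏[1-x^] 0 (suc k) (multiples (suc k)) r + ∏[1-x^] 0 (suc k) (D (suc k)) r)
    ≡⟨ cong (λ z → (B (suc k) r + S) - (z + ∏[1-x^] 0 (suc k) (D (suc k)) r)) ∏multiples≡S ⟩
      (B (suc k) r + S) - (S + ∏[1-x^] 0 (suc k) (D (suc k)) r)
    ≡⟨ cancel (B (suc k) r) S _ ⟩
      E (suc k) r
    ∎
    where
    open ≡-Reasoning
    S : ℤ
    S = (x^ suc k · ∏[1-x^] 0 k one) r
    C≈∏k : C k ≈[≤ r ] ∏[1-x^] 0 k one
    C≈∏k r′ r′≤r = C≈∏ k r′ (ℕ.≤-trans r′≤r r≤n)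
    cancel : ∀ b s p → (b + s) - (s + p) ≡ b - p
    cancel = solve-∀
    ∏multiples≡S : ∏[1-x^] 0 (suc k) (multiples (suc k)) r ≡ S
    ∏multiples≡S = begin
      ∏[1-x^] 0 (suc k) (multiples (suc k)) r          ≡⟨ ∏[1-x^]-from-0 k (multiples (suc k)) r ⟩
      ([1-x^ suc k ]· ∏[1-x^] 0 k (multiples (suc k))) r ≡⟨ [1-x^]-∏[1-x^] (suc k) 0 k (multiples (suc k)) r ⟩
      ∏[1-x^] 0 k ([1-x^ suc k ]· multiples (suc k)) r   ≡⟨ ∏[1-x^]-cong 0 k ([1-x^]-multiples k) r ⟩
      ∏[1-x^] 0 k (x^ suc k · one) r                     ≡⟨ x^-∏[1-x^] (suc k) 0 k one r ⟨
      S                                                  ∎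

  E-n : E n ≈[≤ n ] 0ₛ
  E-n r r≤n = cong₂ _-_ (∑<-zero (suc n) (λ m _ → term m))
                        (trans (∏[1-x^]-cong 0 n D-n r) (∏[1-x^]-0 0 n r))
    where
    term : ∀ m → + m * (x^ (n *ℕ m) · a m) r ≡ 0ℤ
    term zero    = refl
    term (suc m) = trans (cong (+ suc m *_) (trans (x^-x^ (n *ℕ suc m) (suc m) (Q (suc m)) r)
                     (x^-below _ (Q (suc m)) (subst (r <_) (sym (ℕ.+-suc (n *ℕ suc m) m))
                        (s≤s (ℕ.≤-trans r≤n (ℕ.≤-trans (ℕ.m≤m*n n (suc m)) (ℕ.m≤m+n (n *ℕ suc m) m))))))))
                   (ℤ.*-zeroʳ (+ suc m))

  E-vanishes : ∀ g k → g +ℕ k ≡ n → E k ≈[≤ n ] 0ₛ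
  E-vanishes zero    k refl = E-n
  E-vanishes (suc g) k g+k≡n = [1-x^]-cancel (suc k) n (s≤s z≤n)
    (λ r r≤n → trans (E-step k k<n r r≤n) (E-vanishes g (suc k) (trans (ℕ.+-suc g k) g+k≡n) r r≤n))
    where
    k<n : k < n
    k<n = subst (k <_) g+k≡n (s≤s (ℕ.m≤n+m k g))

  B≈D : B 0 ≈[≤ n ] D 0
  B≈D r r≤n = ℤ.i-j≡0⇒i≡j _ _ (E-vanishes n 0 (ℕ.+-identityʳ n) r r≤n)

  coefficient≡d : ∀ R → suc R ≤ n → ∑< n (λ m → + suc m * a (suc m) (suc R)) ≡ + d (suc R)
  coefficient≡d R R<n = begin
    ∑< n (λ m → + suc m * a (suc m) (suc R))   ≡⟨ ℤ.+-identityˡ _ ⟨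
    B 0 (suc R)                                ≡⟨ B≈D (suc R) R<n ⟩
    D 0 (suc R)                                ≡⟨ ∑<multiples≡d n R R<n ⟩
    + d (suc R)                                ∎
    where open ≡-Reasoning

t-suc : ∀ i → t (suc i) ≡ t i +ℕ suc i
t-suc i = begin
  (suc i *ℕ suc (suc i)) / 2             ≡⟨ cong (_/ 2) expand ⟩
  (i *ℕ suc i +ℕ suc i *ℕ 2) / 2         ≡⟨ +-distrib-/-∣ʳ (i *ℕ suc i) (divides (suc i) refl) ⟩
  t i +ℕ (suc i *ℕ 2) / 2                ≡⟨ cong (t i +ℕ_) (m*n/n≡m (suc i) 2) ⟩
  t i +ℕ suc i                           ∎
  where
  open ≡-Reasoning
  expand : suc i *ℕ suc (suc i) ≡ i *ℕ suc i +ℕ suc i *ℕ 2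
  expand = solve (i ∷ [])

m≤t[m] : ∀ m → m ≤ t m
m≤t[m] zero    = z≤n
m≤t[m] (suc m) = subst (suc m ≤_) (sym (t-suc m)) (ℕ.m≤n+m (suc m) (t m))

δ : ℕ → ℕ → ℤ
δ a b = indicator (does (a ≟ b))

δ-≡ : ∀ {a b} → a ≡ b → δ a b ≡ 1ℤ
δ-≡ {a} {b} a≡b = cong indicator (dec-true (a ≟ b) a≡b)

δ-≢ : ∀ {a b} → a ≢ b → δ a b ≡ 0ℤ
δ-≢ {a} {b} a≢b = cong indicator (dec-false (a ≟ b) a≢b)

δ-cong : ∀ {a b c d} → (a ≡ b → c ≡ d) → (c ≡ d → a ≡ b) → δ a b ≡ δ c d
δ-cong {a} {b} to from with a ≟ b
... | yes a≡b = trans (δ-≡ a≡b) (sym (δ-≡ (to a≡b)))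
... | no  a≢b = trans (δ-≢ a≢b) (sym (δ-≢ (a≢b ∘ from)))

x^-one : ∀ m r → (x^ m · one) r ≡ δ m r
x^-one zero    zero    = refl
x^-one zero    (suc r) = refl
x^-one (suc m) zero    = refl
x^-one (suc m) (suc r) = x^-one m r

Amat≡-δ+δ : ∀ i k l → 1 ≤ i → Amat i k l ≡ - δ k l + δ k (l +ℕ i)
Amat≡-δ+δ i k l 1≤i = signed (does (k ≟ l)) (does (k ≟ l +ℕ i)) exclusive
  where
  signed : ∀ b c → (b ≡ true → c ≡ false) → (if b then -1ℤ else indicator c) ≡ - indicator b + indicator c
  signed true  c     excl = cong (_+_ -1ℤ ∘ indicator) (sym (excl refl))
  signed false true  excl = refl
  signed false false excl = refl
  exclusive : does (k ≟ l) ≡ true → does (k ≟ l +ℕ i) ≡ false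
  exclusive k≡ᵇl = dec-false (k ≟ l +ℕ i) (ℕ.<⇒≢ (ℕ.m<m+n l 1≤i) ∘ trans (sym k≡l))
    where
    k≡l : k ≡ l
    k≡l = ℕ.≡ᵇ⇒≡ k l (subst Bool.T (sym k≡ᵇl) tt)

δ*-≡ : ∀ {a b} x → a ≡ b → δ a b * x ≡ x
δ*-≡ x a≡b = trans (cong (_* x) (δ-≡ a≡b)) (ℤ.*-identityˡ x)

δ*-≢ : ∀ {a b} x → a ≢ b → δ a b * x ≡ 0ℤ
δ*-≢ x a≢b = trans (cong (_* x) (δ-≢ a≢b)) (ℤ.*-zeroˡ x)

∑δ-diagonal : ∀ T i (s : Series) → s 0 ≡ 0ℤ → ∀ k →
              ∑< T (λ l → δ k l * s (T ∸ l)) ≡ (x^ i · s) (T +ℕ i ∸ k)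
∑δ-diagonal T i s s0 k with k <? T
... | yes k<T = begin
    ∑< T (λ l → δ k l * s (T ∸ l))   ≡⟨ ∑<-single T _ k (λ l l≢k → δ*-≢ (s (T ∸ l)) (l≢k ∘ sym)) k<T ⟩
    δ k k * s (T ∸ k)                ≡⟨ δ*-≡ {k} (s (T ∸ k)) refl ⟩
    s (T ∸ k)                        ≡⟨ x^-above i s (T ∸ k) ⟨
    (x^ i · s) (i +ℕ (T ∸ k))        ≡⟨ cong (x^ i · s) (trans (ℕ.+-comm i (T ∸ k)) (sym (ℕ.+-∸-comm i (ℕ.<⇒≤ k<T)))) ⟩
    (x^ i · s) (T +ℕ i ∸ k)          ∎
  where open ≡-Reasoning
... | no k≮T = trans (∑<-zero T (λ l l<T → δ*-≢ (s (T ∸ l)) (λ k≡l → k≮T (subst (_< T) (sym k≡l) l<T))))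
                     (sym (x^-upto i s s0 (T +ℕ i ∸ k) index≤i))
  where
  index≤i : T +ℕ i ∸ k ≤ i
  index≤i = subst (T +ℕ i ∸ k ≤_) (ℕ.m+n∸m≡n T i) (ℕ.∸-monoʳ-≤ (T +ℕ i) (ℕ.≮⇒≥ k≮T))

∑δ-offdiagonal : ∀ T i (s : Series) → (∀ r → T < r → s r ≡ 0ℤ) → ∀ k → k < T +ℕ i →
                 ∑< T (λ l → δ k (l +ℕ i) * s (T ∸ l)) ≡ s (T +ℕ i ∸ k)
∑δ-offdiagonal T i s support k k<T+i with offset i k
... | below k<i = trans (∑<-zero T (λ l _ → δ*-≢ (s (T ∸ l)) (ℕ.<⇒≢ (ℕ.<-≤-trans k<i (ℕ.m≤n+m i l)))))
                        (sym (support (T +ℕ i ∸ k) T<index))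
  where
  T<index : T < T +ℕ i ∸ k
  T<index = subst (T <_) (sym (ℕ.+-∸-assoc T (ℕ.<⇒≤ k<i))) (ℕ.m<m+n T (ℕ.m<n⇒0<n∸m k<i))
... | above u = begin
    ∑< T (λ l → δ (i +ℕ u) (l +ℕ i) * s (T ∸ l))  ≡⟨ ∑<-single T _ u (λ l l≢u → δ*-≢ (s (T ∸ l)) (l≢u ∘ sym ∘ cancel l)) u<T ⟩
    δ (i +ℕ u) (u +ℕ i) * s (T ∸ u)               ≡⟨ δ*-≡ (s (T ∸ u)) (ℕ.+-comm i u) ⟩
    s (T ∸ u)                                     ≡⟨ cong s index ⟨
    s (T +ℕ i ∸ (i +ℕ u))                         ∎
  where
  open ≡-Reasoning
  u<T : u < T
  u<T = ℕ.+-cancelˡ-< i u T (subst (i +ℕ u <_) (ℕ.+-comm T i) k<T+i)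
  cancel : ∀ l → i +ℕ u ≡ l +ℕ i → u ≡ l
  cancel l e = ℕ.+-cancelˡ-≡ i u l (trans e (ℕ.+-comm l i))
  index : T +ℕ i ∸ (i +ℕ u) ≡ T ∸ u
  index = trans (cong (_∸ (i +ℕ u)) (ℕ.+-comm T i)) (ℕ.[m+n]∸[m+o]≡n∸o i T u)

-- v (l + 1) = s (T ∸ l) reads a vector v of length T backwards; entry k + 1 of A_{i,i-1} v then sits
-- at the reversed position T + i ∸ k.
∑Amat-reversed : ∀ T i (s : Series) → 1 ≤ i → s 0 ≡ 0ℤ → (∀ r → T < r → s r ≡ 0ℤ) →
                 ∀ k → k < T +ℕ i → ∑< T (λ l → Amat i (suc k) (suc l) * s (T ∸ l)) ≡ ([1-x^ i ]· s) (T +ℕ i ∸ k)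
∑Amat-reversed T i s 1≤i s0 support k k<T+i = begin
    ∑< T (λ l → Amat i (suc k) (suc l) * s (T ∸ l))
  ≡⟨ ∑<-cong T (λ l _ → trans (cong (_* s (T ∸ l)) (Amat≡-δ+δ i (suc k) (suc l) 1≤i)) (swap (δ k l) _ _)) ⟩
    ∑< T (λ l → δ k (l +ℕ i) * s (T ∸ l) - δ k l * s (T ∸ l))
  ≡⟨ ∑<-- T _ _ ⟩
    ∑< T (λ l → δ k (l +ℕ i) * s (T ∸ l)) - ∑< T (λ l → δ k l * s (T ∸ l))
  ≡⟨ cong₂ _-_ (∑δ-offdiagonal T i s support k k<T+i) (∑δ-diagonal T i s s0 k) ⟩
    s (T +ℕ i ∸ k) - (x^ i · s) (T +ℕ i ∸ k)
  ∎
  where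
  open ≡-Reasoning
  swap : ∀ a b x → (- a + b) * x ≡ b * x - a * x
  swap = solve-∀

reversedChain : ℕ → ℕ → Series
reversedChain m j = x^ m · ∏[1-x^] m j one

reversedChain-suc : ∀ m j → reversedChain m (suc j) ≗ [1-x^ suc j +ℕ m ]· reversedChain m j
reversedChain-suc m j = x^-[1-x^] m (suc j +ℕ m) (∏[1-x^] m j one)

reversedChain-support : ∀ m j r → t (j +ℕ m) < r → reversedChain m j r ≡ 0ℤ
reversedChain-support m zero    r t<r = trans (x^-one m r) (δ-≢ (λ m≡r → ℕ.<⇒≱ t<r (subst (_≤ t m) m≡r (m≤t[m] m))))
reversedChain-support m (suc j) r t<r = trans (reversedChain-suc m j r)
    (cong₂ _-_ (reversedChain-support m j r T<r) (shifted (offset i r) T+i<r))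
  where
  T i : ℕ
  T = t (j +ℕ m)
  i = suc j +ℕ m
  T+i<r : T +ℕ i < r
  T+i<r = subst (_< r) (t-suc (j +ℕ m)) t<r
  T<r : T < r
  T<r = ℕ.≤-trans (s≤s (ℕ.m≤m+n T i)) T+i<r
  shifted : ∀ {r} → Offset i r → T +ℕ i < r → (x^ i · reversedChain m j) r ≡ 0ℤ
  shifted (below r<i) _      = x^-below i _ r<i
  shifted (above u)   T+i<r′ = trans (x^-above i _ u)
    (reversedChain-support m j u (ℕ.+-cancelˡ-< i T u (subst (_< i +ℕ u) (ℕ.+-comm T i) T+i<r′)))

chain≡reversedChain : ∀ m j k → 1 ≤ k → k ≤ t (j +ℕ suc m) →
                      chainAux (suc m) j k ≡ reversedChain (suc m) j (suc (t (j +ℕ suc m)) ∸ k)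
chain≡reversedChain m zero k 1≤k k≤t = trans (δ-cong to from) (sym (x^-one (suc m) (suc (t (suc m)) ∸ k)))
  where
  to : k ≡ suc (t m) → suc m ≡ suc (t (suc m)) ∸ k
  to refl = sym (trans (cong (_∸ t m) (t-suc m)) (ℕ.m+n∸m≡n (t m) (suc m)))
  from : suc m ≡ suc (t (suc m)) ∸ k → k ≡ suc (t m)
  from e = ℕ.+-cancelʳ-≡ (suc m) k (suc (t m)) (begin
    k +ℕ suc m                         ≡⟨ cong (k +ℕ_) e ⟩
    k +ℕ (suc (t (suc m)) ∸ k)         ≡⟨ ℕ.m+[n∸m]≡n (ℕ.m≤n⇒m≤1+n k≤t) ⟩
    suc (t (suc m))                    ≡⟨ cong suc (t-suc m) ⟩
    suc (t m) +ℕ suc m                 ∎)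
    where open ≡-Reasoning
chain≡reversedChain m (suc j) (suc k) 1≤k k≤t = begin
    Σ1 T (λ l → Amat i (suc k) l * chainAux (suc m) j l)
  ≡⟨ Σ1≡∑< T (λ l → Amat i (suc k) l * chainAux (suc m) j l) ⟩
    ∑< T (λ l → Amat i (suc k) (suc l) * chainAux (suc m) j (suc l))
  ≡⟨ ∑<-cong T (λ l l<T → cong (Amat i (suc k) (suc l) *_) (chain≡reversedChain m j (suc l) (s≤s z≤n) l<T)) ⟩
    ∑< T (λ l → Amat i (suc k) (suc l) * reversedChain (suc m) j (T ∸ l))
  ≡⟨ ∑Amat-reversed T i _ (s≤s z≤n) refl (reversedChain-support (suc m) j) k k<T+i ⟩
    ([1-x^ i ]· reversedChain (suc m) j) (T +ℕ i ∸ k)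
  ≡⟨ reversedChain-suc (suc m) j (T +ℕ i ∸ k) ⟨
    reversedChain (suc m) (suc j) (T +ℕ i ∸ k)
  ≡⟨ cong (λ x → reversedChain (suc m) (suc j) (x ∸ k)) (t-suc (j +ℕ suc m)) ⟨
    reversedChain (suc m) (suc j) (t (suc j +ℕ suc m) ∸ k)
  ∎
  where
  open ≡-Reasoning
  T i : ℕ
  T = t (j +ℕ suc m)
  i = suc j +ℕ suc m
  k<T+i : k < T +ℕ i
  k<T+i = subst (suc k ≤_) (t-suc (j +ℕ suc m)) k≤t

Evec-reversed : ∀ n k → 1 ≤ k → k ≤ t n →
  Evec n k ≡ ∑< n (λ m → + suc m * reversedChain (suc m) (n ∸ suc m) (suc (t n) ∸ k))
Evec-reversed n k 1≤k k≤t = trans (Σ1≡∑< n (λ m → + m * chain n m k)) (∑<-cong n summand)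
  where
  summand : ∀ m → m < n → + suc m * chain n (suc m) k ≡ + suc m * reversedChain (suc m) (n ∸ suc m) (suc (t n) ∸ k)
  summand m m<n = cong (+ suc m *_) (trans
      (chain≡reversedChain m (n ∸ suc m) k 1≤k (subst (λ x → k ≤ t x) (sym n∸m+m≡n) k≤t))
      (cong (λ x → reversedChain (suc m) (n ∸ suc m) (suc (t x) ∸ k)) n∸m+m≡n))
    where
    n∸m+m≡n : n ∸ suc m +ℕ suc m ≡ n
    n∸m+m≡n = ℕ.m∸n+n≡m m<n

mainTheorem9 : (n : ℕ) → 1 ≤ n → (j : ℕ) → 1 ≤ j → j ≤ n →
    Evec n (t (n ∸ 1) +ℕ j) ≡ + d (n +ℕ 1 ∸ j)
mainTheorem9 (suc n) _ (suc j) _ (s≤s j≤n) = begin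
    Evec (suc n) k
  ≡⟨ Evec-reversed (suc n) k (ℕ.≤-trans (s≤s z≤n) (ℕ.m≤n+m (suc j) (t n))) k≤t ⟩
    ∑< (suc n) (λ m → + suc m * reversedChain (suc m) (suc n ∸ suc m) (suc (t (suc n)) ∸ k))
  ≡⟨ cong (λ R → ∑< (suc n) (λ m → + suc m * reversedChain (suc m) (suc n ∸ suc m) R)) index ⟩
    ∑< (suc n) (λ m → + suc m * reversedChain (suc m) (suc n ∸ suc m) (suc (n ∸ j)))
  ≡⟨ DivisorSeries.coefficient≡d (suc n) (n ∸ j) (s≤s (ℕ.m∸n≤m n j)) ⟩
    + d (suc (n ∸ j))
  ≡⟨ cong (+_ ∘ d) (trans (cong (_∸ j) (ℕ.+-comm n 1)) (ℕ.+-∸-assoc 1 j≤n)) ⟨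
    + d (suc n +ℕ 1 ∸ suc j)
  ∎
  where
  open ≡-Reasoning
  k : ℕ
  k = t n +ℕ suc j
  k≤t : k ≤ t (suc n)
  k≤t = subst (k ≤_) (sym (t-suc n)) (ℕ.+-monoʳ-≤ (t n) (s≤s j≤n))
  index : suc (t (suc n)) ∸ k ≡ suc (n ∸ j)
  index = begin
    suc (t (suc n)) ∸ k               ≡⟨ cong (λ x → suc x ∸ k) (t-suc n) ⟩
    suc (t n +ℕ suc n) ∸ k            ≡⟨ cong (_∸ k) (ℕ.+-suc (t n) (suc n)) ⟨
    t n +ℕ suc (suc n) ∸ k            ≡⟨ ℕ.[m+n]∸[m+o]≡n∸o (t n) (suc (suc n)) (suc j) ⟩
    suc n ∸ j                         ≡⟨ ℕ.+-∸-assoc 1 j≤n ⟩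
    suc (n ∸ j)                       ∎
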